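{- Let $s,t\in\mathbb{R}$ with $s\neq0$, $t\neq0$ (and $s^2+4t\neq0$). For all $n\in\mathbb{N}$, \[ \genfrac{\{}{\}}{0pt}{}{n+2}{2}_{s,t}^2-t^2\genfrac{\{}{\}}{0pt}{}{n+1}{2}_{s,t}^2=\left(\frac{\{n+2\}_{s,t}+t\{n\}_{s,t}}{s}\right)\{n+1\}_{s,t}^3 . \]
   Context: Generalized Fibonacci polynomials: $\{0\}_{s,t}=0$, $\{1\}_{s,t}=1$, $\{n+2\}_{s,t}=s\{n+1\}_{s,t}+t\{n\}_{s,t}$. The generalized triangular numbers are $\genfrac{\{}{\}}{0pt}{}{n+1}{2}_{s,t}=\frac{\{n\}_{s,t}\{n+1\}_{s,t}}{\{2\}_{s,t}}=\frac{\{n\}_{s,t}\{n+1\}_{s,t}}{s}$. -}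

module Defs where

open import Level using (Level; suc; _⊔_)
open import Data.Nat using (ℕ; zero) renaming (suc to sucℕ)
open import Relation.Nullary using (¬_)
open import Algebra.Bundles using (CommutativeRing)

-- The inverse is a total operation (its value at 0
-- is irrelevant); only its behaviour on nonzero elements is constrained.
record Field (c ℓ : Level) : Set (suc (c ⊔ ℓ)) where
  field
    commutativeRing : CommutativeRing c ℓ
  open CommutativeRing commutativeRing public
  field
    _⁻¹       : Carrier → Carrier
    ⁻¹-inverse : ∀ x → ¬ (x ≈ 0#) → x * (x ⁻¹) ≈ 1#
    0≉1        : ¬ (0# ≈ 1#)

module _ {c ℓ : Level} (F : Field c ℓ) where
  open Field F

  fib : Carrier → Carrier → ℕ → Carrier
  fib s t zero = 0#
  fib s t (sucℕ zero) = 1#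
  fib s t (sucℕ (sucℕ n)) = s * fib s t (sucℕ n) + t * fib s t n

  -- generalized triangular number  {n+1 choose 2}_{s,t} = {n}{n+1}/{2},
  -- with {2}_{s,t} = s ; here  tri s t n  denotes  {n+1 choose 2}_{s,t}
  tri : Carrier → Carrier → ℕ → Carrier
  tri s t n = (fib s t n * fib s t (sucℕ n)) * (s ⁻¹)

-- Write a = {n}, b = {n+1}, c = {n+2} = s b + t a.  Up to the factor s⁻² the
-- left side is b² (c² − t² a²) = b² (c − t a)(c + t a), and c − t a = s b by the
-- recurrence; one factor s then cancels against s⁻¹.
module Submission where

open import Defs
open import Level using (Level)
open import Data.Nat using (ℕ; suc)
open import Relation.Nullary using (¬_)
open import Algebra.Bundles using (CommutativeRing)
import Algebra.Solver.Ring.NaturalCoefficients.Default as NaturalCoefficientsSolver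
import Relation.Binary.Reasoning.Setoid as SetoidReasoning

module _ {c ℓ : Level} (R : CommutativeRing c ℓ) where
  open CommutativeRing R
  open NaturalCoefficientsSolver commutativeSemiring

  -- Polynomial form of the theorem, with i standing for s⁻¹ and the
  -- subtraction moved to the other side so that it is a semiring identity.
  triangular-square-difference-polynomial : ∀ a b s t i →
    ((b * (s * b + t * a)) * i) * ((b * (s * b + t * a)) * i)
      ≈ ((((s * b + t * a) + t * a) * i) * (b * b * b)) * (s * i)
        + (t * t) * (((a * b) * i) * ((a * b) * i))
  triangular-square-difference-polynomial = solve 5 (λ a b s t i →
    ((b :* (s :* b :+ t :* a)) :* i) :* ((b :* (s :* b :+ t :* a)) :* i)
      := ((((s :* b :+ t :* a) :+ t :* a) :* i) :* (b :* b :* b)) :* (s :* i)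
         :+ (t :* t) :* (((a :* b) :* i) :* ((a :* b) :* i))) refl

  x+y-y≈x : ∀ x y → (x + y) - y ≈ x
  x+y-y≈x x y = begin
    (x + y) - y  ≈⟨ +-assoc x y (- y) ⟩
    x + (y - y)  ≈⟨ +-congˡ (-‿inverseʳ y) ⟩
    x + 0#       ≈⟨ +-identityʳ x ⟩
    x            ∎
    where open SetoidReasoning setoid

mainTheorem12 : ∀ {c ℓ : Level} (F : Field c ℓ) → let open Field F in
    ∀ (s t : Carrier) → ¬ (s ≈ 0#) → ¬ (t ≈ 0#) → ¬ ((s * s + (1# + 1# + 1# + 1#) * t) ≈ 0#) →
    ∀ (n : ℕ) →
    (tri F s t (suc n) * tri F s t (suc n)) - (t * t) * (tri F s t n * tri F s t n)
    ≈ ((fib F s t (suc (suc n)) + t * fib F s t n) * (s ⁻¹))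
    * (fib F s t (suc n) * fib F s t (suc n) * fib F s t (suc n))
mainTheorem12 F s t s≉0 _ _ n = begin
    X - Z                     ≈⟨ +-congʳ (triangular-square-difference-polynomial
                                   commutativeRing (fib F s t n) (fib F s t (suc n)) s t (s ⁻¹)) ⟩
    (Y * (s * s ⁻¹) + Z) - Z  ≈⟨ x+y-y≈x commutativeRing (Y * (s * s ⁻¹)) Z ⟩
    Y * (s * s ⁻¹)            ≈⟨ *-congˡ (⁻¹-inverse s s≉0) ⟩
    Y * 1#                    ≈⟨ *-identityʳ Y ⟩
    Y                         ∎
  where
  open Field F
  open SetoidReasoning setoid
  X Y Z : Carrier
  X = tri F s t (suc n) * tri F s t (suc n)
  Z = (t * t) * (tri F s t n * tri F s t n)
  Y = ((fib F s t (suc (suc n)) + t * fib F s t n) * (s ⁻¹))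
    * (fib F s t (suc n) * fib F s t (suc n) * fib F s t (suc n))
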